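{- Let $(\mathcal{A},\leq,\otimes,\neg)$ be a conjunctive structure. For all typing contexts $\Gamma,\Delta$, all formulas with parameters $A$ and all substitutions $\sigma$ such that $\sigma\Vdash\Gamma$ and $\sigma\Vdash\Delta$: (1) for any term $t$, if $\Gamma\vdash t:A\mid\Delta$ then $(t[\sigma])^\mathcal{A}\leq A[\sigma]^\mathcal{A}$; (2) for any context $e$, if $\Gamma\mid e:A\vdash\Delta$ then $(e[\sigma])^\mathcal{A}\geq A[\sigma]^\mathcal{A}$; (3) for any command $c$, if $c:(\Gamma\vdash\Delta)$ then $(c[\sigma])^\mathcal{A}$ belongs to the pole, i.e. for $c=\langle t\| e\rangle$, $(t[\sigma])^\mathcal{A}\leq(e[\sigma])^\mathcal{A}$.
   Context: A conjunctive structure is a quadruple $(\mathcal{A},\leq,\otimes,\neg)$ where $(\mathcal{A},\leq)$ is a complete lattice (meets $\bigwedge$, joins $\bigvee$), $\otimes$ is binary and monotone in both arguments, $\neg$ is unary and antitone, $\bigvee_{b\in B}(a\otimes b)=a\otimes\bigvee_{b\in B}b$ and $\bigvee_{b\in B}(b\otimes a)=(\bigvee_{b\in B}b)\otimes a$, and $\neg(\bigvee_{b\in B}b)=\bigwedge_{b\in B}\neg b$. The calculus $\mathrm{L}^{\otimes}$ has terms $t::=x\mid(t,t)\mid[e]\mid\mu\alpha.c$, values $V::=x\mid(V,V)\mid[e]$, contexts $e::=\alpha\mid\mu(x,y).c\mid\mu[\alpha].c\mid\mu x.c$, commands $c::=\langle t\| e\rangle$, and formulas with parameters $A,B::=a\mid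 X\mid A\otimes B\mid\neg A\mid\exists X.A$ ($a\in\mathcal{A}$). Typing rules: (Cut) from $\Gamma\vdash t:A\mid\Delta$ and $\Gamma\mid e:A\vdash\Delta$ infer $\langle t\| e\rangle:(\Gamma\vdash\Delta)$; axioms $\Gamma\mid\alpha:A\vdash\Delta$ if $(\alpha:A)\in\Delta$ and $\Gamma\vdash x:A\mid\Delta$ if $(x:A)\in\Gamma$; from $c:(\Gamma,x:A\vdash\Delta)$ infer $\Gamma\mid\mu x.c:A\vdash\Delta$; from $c:(\Gamma,x:A,x':B\vdash\Delta)$ infer $\Gamma\mid\mu(x,x').c:A\otimes B\vdash\Delta$; from $c:(\Gamma\vdash\Delta,\alpha:A)$ infer $\Gamma\mid\mu[\alpha].c:\neg A\vdash\Delta$; from $c:(\Gamma\vdash\Delta,\alpha:A)$ infer $\Gamma\vdash\mu\alpha.c:A\mid\Delta$; from $\Gamma\vdash t:A\mid\Delta$ and $\Gamma\vdash u:B\mid\Delta$ infer $\Gamma\vdash(t,u):A\otimes B\mid\Delta$; from $\Gamma\mid e:A\vdash\Delta$ infer $\Gamma\vdash[e]:\neg A\mid\Delta$; from $\Gamma\mid e:A\vdash\Delta$ with $X$ not free in $\Gamma,\Delta$ infer $\Gamma\mid e:\exists X.A\vdash\Delta$; from $\Gamma\vdash V:A[B/X]\mid\Delta$ infer $\Gamma\vdash V:\exists X.A\mid\Delta$. A command $(a,b)$ is in the pole iff $a\leq b$. Interpretation: $a^\mathcal{A}=a$; $(t,u)^\mathcal{A}=t^\mathcal{A}\otimes u^\mathcal{A}$;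 $[e]^\mathcal{A}=\neg e^\mathcal{A}$; $(\mu\alpha.c)^\mathcal{A}=\bigwedge\{a:(c[\alpha:=a])^\mathcal{A}\text{ in the pole}\}$; $(\mu x.c)^\mathcal{A}=\bigvee\{a:(c[x:=a])^\mathcal{A}\text{ in the pole}\}$; $(\mu(x,y).c)^\mathcal{A}=\bigvee\{a\otimes b:(c[x:=a,y:=b])^\mathcal{A}\text{ in the pole}\}$; $(\mu[\alpha].c)^\mathcal{A}=\bigvee\{\neg a:(c[\alpha:=a])^\mathcal{A}\text{ in the pole}\}$; $\langle t\| e\rangle^\mathcal{A}=(t^\mathcal{A},e^\mathcal{A})$. Formulas: $a^\mathcal{A}=a$, $(\neg A)^\mathcal{A}=\neg A^\mathcal{A}$, $(A\otimes B)^\mathcal{A}=A^\mathcal{A}\otimes B^\mathcal{A}$, $(\exists X.A)^\mathcal{A}=\bigvee_{a\in\mathcal{A}}(A\{X:=a\})^\mathcal{A}$. Substitutions $\sigma$ map variables to elements of $\mathcal{A}$; $\sigma\Vdash\Gamma$ if $\sigma(x)\leq(A[\sigma])^\mathcal{A}$ for $(x:A)\in\Gamma$, and $\sigma\Vdash\Delta$ if $\sigma(\alpha)\geq(A[\sigma])^\mathcal{A}$ for $(\alpha:A)\in\Delta$. -}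

module Defs where

open import Level using (Level)
open import Data.Nat using (ℕ) renaming (suc to sucℕ)
open import Data.Fin using (Fin; zero; suc)
open import Data.Vec using (Vec; lookup; map)
open import Data.Vec.Functional using (Vector; _∷_)
open import Data.Product using (Σ; _×_; _,_)
open import Relation.Binary.PropositionalEquality using (_≡_)
open import Relation.Binary.Structures using (IsPartialOrder)

Image : ∀ {ℓ} {C : Set ℓ} → (C → C) → (C → Set ℓ) → C → Set ℓ
Image {C = C} f P z = Σ C (λ b → P b × (z ≡ f b))

record ConjunctiveStructure (ℓ : Level) : Set (Level.suc ℓ) where
  infix  4 _≤_
  infixl 7 _⊗_
  field
    -- complete lattice (subsets of the carrier are predicates)
    Carrier        : Set ℓ
    _≤_            : Carrier → Carrier → Set ℓ
    isPartialOrder : IsPartialOrder _≡_ _≤_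
    ⋁              : (Carrier → Set ℓ) → Carrier
    ⋀              : (Carrier → Set ℓ) → Carrier
    ⋁-upper        : ∀ (P : Carrier → Set ℓ) a → P a → a ≤ ⋁ P
    ⋁-least        : ∀ (P : Carrier → Set ℓ) b → (∀ a → P a → a ≤ b) → ⋁ P ≤ b
    ⋀-lower        : ∀ (P : Carrier → Set ℓ) a → P a → ⋀ P ≤ a
    ⋀-greatest     : ∀ (P : Carrier → Set ℓ) b → (∀ a → P a → b ≤ a) → b ≤ ⋀ P
    _⊗_            : Carrier → Carrier → Carrier
    ¬_             : Carrier → Carrier
    ⊗-mono         : ∀ {a a′ b b′} → a ≤ a′ → b ≤ b′ → a ⊗ b ≤ a′ ⊗ b′
    ¬-anti         : ∀ {a b} → a ≤ b → ¬ b ≤ ¬ a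
    ⊗-distribˡ-⋁   : ∀ a (B : Carrier → Set ℓ) → ⋁ (Image (a ⊗_) B) ≡ a ⊗ ⋁ B
    ⊗-distribʳ-⋁   : ∀ a (B : Carrier → Set ℓ) → ⋁ (Image (_⊗ a) B) ≡ ⋁ B ⊗ a
    ¬-⋁            : ∀ (B : Carrier → Set ℓ) → ¬ (⋁ B) ≡ ⋀ (Image ¬_ B)

module Lang {ℓ : Level} (𝒜 : ConjunctiveStructure ℓ) where
  open ConjunctiveStructure 𝒜

  -- Formulas with parameters, with k free second-order variables (de Bruijn)
  data Form (k : ℕ) : Set ℓ where
    par  : Carrier → Form k
    tvar : Fin k → Form k
    _⊗ᶠ_ : Form k → Form k → Form k
    ¬ᶠ   : Form k → Form k
    ∃ᶠ   : Form (sucℕ k) → Form k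

  ext : ∀ {k k′} → (Fin k → Fin k′) → Fin (sucℕ k) → Fin (sucℕ k′)
  ext r zero    = zero
  ext r (suc i) = suc (r i)

  ren : ∀ {k k′} → (Fin k → Fin k′) → Form k → Form k′
  ren r (par a)    = par a
  ren r (tvar i)   = tvar (r i)
  ren r (A ⊗ᶠ B)   = ren r A ⊗ᶠ ren r B
  ren r (¬ᶠ A)     = ¬ᶠ (ren r A)
  ren r (∃ᶠ A)     = ∃ᶠ (ren (ext r) A)

  weaken : ∀ {k} → Form k → Form (sucℕ k)
  weaken = ren suc

  exts : ∀ {k k′} → (Fin k → Form k′) → Fin (sucℕ k) → Form (sucℕ k′)
  exts s zero    = tvar zero
  exts s (suc i) = weaken (s i)

  sub : ∀ {k k′} → (Fin k → Form k′) → Form k → Form k′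
  sub s (par a)  = par a
  sub s (tvar i) = s i
  sub s (A ⊗ᶠ B) = sub s A ⊗ᶠ sub s B
  sub s (¬ᶠ A)   = ¬ᶠ (sub s A)
  sub s (∃ᶠ A)   = ∃ᶠ (sub (exts s) A)

  -- A [ B / X ]  where X is the outermost bound variable (index 0)
  _[_/0] : ∀ {k} → Form (sucℕ k) → Form k → Form k
  A [ B /0] = sub s A
    where
      s : Fin (sucℕ _) → Form _
      s zero    = B
      s (suc i) = tvar i

  -- Terms, contexts (co-terms) and commands, with n term variables
  -- and m co-variables in scope (de Bruijn)
  mutual
    data Term (n m : ℕ) : Set where
      var  : Fin n → Term n m
      pair : Term n m → Term n m → Term n m
      [_]  : Ctx n m → Term n m
      μ    : Cmd n (sucℕ m) → Term n m
    data Ctx (n m : ℕ) : Set where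
      covar : Fin m → Ctx n m
      μpair : Cmd (sucℕ (sucℕ n)) m → Ctx n m   -- μ(x,y).c  (x = index 1, y = index 0)
      μneg  : Cmd n (sucℕ m) → Ctx n m
      μ̃     : Cmd (sucℕ n) m → Ctx n m
    data Cmd (n m : ℕ) : Set where
      ⟨_∥_⟩ : Term n m → Ctx n m → Cmd n m

  data IsValue {n m : ℕ} : Term n m → Set where
    var  : ∀ x → IsValue (var x)
    pair : ∀ {V W} → IsValue V → IsValue W → IsValue (pair V W)
    [_]  : ∀ e → IsValue [ e ]

  mutual
    data _⊢_∶_∣_ {k n m : ℕ} (Γ : Vec (Form k) n) : Term n m → Form k → Vec (Form k) m → Set ℓ where
      ax   : ∀ {Δ A} x → lookup Γ x ≡ A → Γ ⊢ var x ∶ A ∣ Δ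
      μR   : ∀ {Δ A c} → c ∶⟪ Γ ⊢ (A Data.Vec.∷ Δ) ⟫ → Γ ⊢ μ c ∶ A ∣ Δ
      ⊗R   : ∀ {Δ A B t u} → Γ ⊢ t ∶ A ∣ Δ → Γ ⊢ u ∶ B ∣ Δ → Γ ⊢ pair t u ∶ A ⊗ᶠ B ∣ Δ
      ¬R   : ∀ {Δ A e} → Γ ∣ e ∶ A ⊢ Δ → Γ ⊢ [ e ] ∶ ¬ᶠ A ∣ Δ
      ∃R   : ∀ {Δ A B V} → IsValue V → Γ ⊢ V ∶ A [ B /0] ∣ Δ → Γ ⊢ V ∶ ∃ᶠ A ∣ Δ

    data _∣_∶_⊢_ {k n m : ℕ} (Γ : Vec (Form k) n) : Ctx n m → Form k → Vec (Form k) m → Set ℓ where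
      ax   : ∀ {Δ A} α → lookup Δ α ≡ A → Γ ∣ covar α ∶ A ⊢ Δ
      μ̃L   : ∀ {Δ A c} → c ∶⟪ (A Data.Vec.∷ Γ) ⊢ Δ ⟫ → Γ ∣ μ̃ c ∶ A ⊢ Δ
      ⊗L   : ∀ {Δ A B c} → c ∶⟪ (B Data.Vec.∷ A Data.Vec.∷ Γ) ⊢ Δ ⟫ → Γ ∣ μpair c ∶ A ⊗ᶠ B ⊢ Δ
      ¬L   : ∀ {Δ A c} → c ∶⟪ Γ ⊢ (A Data.Vec.∷ Δ) ⟫ → Γ ∣ μneg c ∶ ¬ᶠ A ⊢ Δ
      -- X not free in Γ, Δ: the premise lives in the weakened contexts
      ∃L   : ∀ {Δ A e} → map weaken Γ ∣ e ∶ A ⊢ map weaken Δ → Γ ∣ e ∶ ∃ᶠ A ⊢ Δ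

    data _∶⟪_⊢_⟫ {k n m : ℕ} : Cmd n m → Vec (Form k) n → Vec (Form k) m → Set ℓ where
      cut  : ∀ {Γ Δ A t e} → Γ ⊢ t ∶ A ∣ Δ → Γ ∣ e ∶ A ⊢ Δ → ⟨ t ∥ e ⟩ ∶⟪ Γ ⊢ Δ ⟫

  -- A substitution σ assigning elements of 𝒜 to all
  -- variables is given by three environments; (t[σ])^𝒜 is ⟦ t ⟧ σ, and the
  -- binders (c[α:=a])^𝒜 are computed by extending the environment.

  Pole : Carrier × Carrier → Set ℓ
  Pole (a , b) = a ≤ b

  ⟦_⟧F : ∀ {k} → Form k → Vector Carrier k → Carrier
  ⟦ par a ⟧F  ρ = a
  ⟦ tvar i ⟧F ρ = ρ i
  ⟦ A ⊗ᶠ B ⟧F ρ = ⟦ A ⟧F ρ ⊗ ⟦ B ⟧F ρ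
  ⟦ ¬ᶠ A ⟧F   ρ = ¬ (⟦ A ⟧F ρ)
  ⟦ ∃ᶠ A ⟧F   ρ = ⋁ (λ z → Σ Carrier (λ a → z ≡ ⟦ A ⟧F (a ∷ ρ)))

  mutual
    ⟦_⟧t : ∀ {n m} → Term n m → Vector Carrier n → Vector Carrier m → Carrier
    ⟦ var x ⟧t    ρx ρα = ρx x
    ⟦ pair t u ⟧t ρx ρα = ⟦ t ⟧t ρx ρα ⊗ ⟦ u ⟧t ρx ρα
    ⟦ [ e ] ⟧t    ρx ρα = ¬ (⟦ e ⟧e ρx ρα)
    ⟦ μ c ⟧t      ρx ρα = ⋀ (λ a → Pole (⟦ c ⟧c ρx (a ∷ ρα)))

    ⟦_⟧e : ∀ {n m} → Ctx n m → Vector Carrier n → Vector Carrier m → Carrier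
    ⟦ covar α ⟧e ρx ρα = ρα α
    ⟦ μpair c ⟧e ρx ρα =
      ⋁ (λ z → Σ Carrier (λ a → Σ Carrier (λ b →
           (z ≡ a ⊗ b) × Pole (⟦ c ⟧c (b ∷ (a ∷ ρx)) ρα))))
    ⟦ μneg c ⟧e  ρx ρα = ⋁ (λ z → Σ Carrier (λ a → (z ≡ ¬ a) × Pole (⟦ c ⟧c ρx (a ∷ ρα))))
    ⟦ μ̃ c ⟧e     ρx ρα = ⋁ (λ a → Pole (⟦ c ⟧c (a ∷ ρx) ρα))

    ⟦_⟧c : ∀ {n m} → Cmd n m → Vector Carrier n → Vector Carrier m → Carrier × Carrier
    ⟦ ⟨ t ∥ e ⟩ ⟧c ρx ρα = ⟦ t ⟧t ρx ρα , ⟦ e ⟧e ρx ρα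

  _⊩Γ_ : ∀ {k n} → (Vector Carrier k × Vector Carrier n) → Vec (Form k) n → Set ℓ
  (ρX , ρx) ⊩Γ Γ = ∀ x → ρx x ≤ ⟦ lookup Γ x ⟧F ρX

  _⊩Δ_ : ∀ {k m} → (Vector Carrier k × Vector Carrier m) → Vec (Form k) m → Set ℓ
  (ρX , ρα) ⊩Δ Δ = ∀ α → ⟦ lookup Δ α ⟧F ρX ≤ ρα α

-- Soundness is a mutual induction on derivations in which every typing rule is
-- matched by a law of the structure: μ-binders by ⋀-lower and ⋁-upper, pairing
-- and negation by monotonicity of ⊗ and antitonicity of ¬, and the ∃-rules by
-- the two defining properties of ⋁. The ∃-rules additionally need the semantic
-- substitution lemma ⟦ A [ B / X ] ⟧ = ⟦ A ⟧ at X := ⟦ B ⟧ and the invariance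
-- of ⟦ A ⟧ under weakening.
module Submission where

open import Defs
open import Data.Nat using (ℕ)
open import Data.Fin using (Fin; zero; suc)
open import Data.Vec using (Vec; lookup; map)
import Data.Vec as Vec
open import Data.Vec.Properties using (lookup-map)
open import Data.Vec.Functional using (Vector; _∷_)
open import Data.Product using (_×_; _,_)
open import Relation.Binary.PropositionalEquality using (_≡_; refl; sym; trans; cong; cong₂; module ≡-Reasoning)
open import Relation.Binary.Structures using (IsPartialOrder)
open import Relation.Binary.Bundles using (Poset)
import Relation.Binary.Reasoning.PartialOrder as ≤-Reasoning

module Soundness {ℓ} (𝒜 : ConjunctiveStructure ℓ) where
  open ConjunctiveStructure 𝒜
  open Lang 𝒜
  open IsPartialOrder isPartialOrder using (antisym)
    renaming (refl to ≤-refl; reflexive to ≤-reflexive; trans to ≤-trans)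

  ≤-poset : Poset ℓ ℓ ℓ
  ≤-poset = record { isPartialOrder = isPartialOrder }

  ∃ᶠ-intro : ∀ {k} (A : Form (ℕ.suc k)) a ρ → ⟦ A ⟧F (a ∷ ρ) ≤ ⟦ ∃ᶠ A ⟧F ρ
  ∃ᶠ-intro A a ρ = ⋁-upper _ _ (a , refl)

  ∃ᶠ-elim : ∀ {k} (A : Form (ℕ.suc k)) ρ {b} → (∀ a → ⟦ A ⟧F (a ∷ ρ) ≤ b) → ⟦ ∃ᶠ A ⟧F ρ ≤ b
  ∃ᶠ-elim A ρ A≤b = ⋁-least _ _ λ { _ (a , refl) → A≤b a }

  -- Antisymmetry makes denotations of formulas propositionally equal even though
  -- ∃ᶠ is interpreted as a join over a predicate, so no function extensionality
  -- is needed.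
  ∃ᶠ-cong : ∀ {k k′} (A : Form (ℕ.suc k)) (B : Form (ℕ.suc k′)) ρ ρ′ →
            (∀ a → ⟦ A ⟧F (a ∷ ρ) ≡ ⟦ B ⟧F (a ∷ ρ′)) → ⟦ ∃ᶠ A ⟧F ρ ≡ ⟦ ∃ᶠ B ⟧F ρ′
  ∃ᶠ-cong A B ρ ρ′ A≗B = antisym
    (∃ᶠ-elim A ρ  λ a → ≤-trans (≤-reflexive (A≗B a)) (∃ᶠ-intro B a ρ′))
    (∃ᶠ-elim B ρ′ λ a → ≤-trans (≤-reflexive (sym (A≗B a))) (∃ᶠ-intro A a ρ))

  ⟦⟧F-ren : ∀ {k k′} (r : Fin k → Fin k′) (A : Form k) {ρ ρ′} →
            (∀ i → ρ (r i) ≡ ρ′ i) → ⟦ ren r A ⟧F ρ ≡ ⟦ A ⟧F ρ′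
  ⟦⟧F-ren r (par a)  ρr≗ρ′ = refl
  ⟦⟧F-ren r (tvar i) ρr≗ρ′ = ρr≗ρ′ i
  ⟦⟧F-ren r (A ⊗ᶠ B) ρr≗ρ′ = cong₂ _⊗_ (⟦⟧F-ren r A ρr≗ρ′) (⟦⟧F-ren r B ρr≗ρ′)
  ⟦⟧F-ren r (¬ᶠ A)   ρr≗ρ′ = cong ¬_ (⟦⟧F-ren r A ρr≗ρ′)
  ⟦⟧F-ren r (∃ᶠ A) {ρ} {ρ′} ρr≗ρ′ = ∃ᶠ-cong (ren (ext r) A) A ρ ρ′ λ a →
    ⟦⟧F-ren (ext r) A λ { zero → refl ; (suc i) → ρr≗ρ′ i }

  ⟦⟧F-weaken : ∀ {k} (A : Form k) a ρ → ⟦ weaken A ⟧F (a ∷ ρ) ≡ ⟦ A ⟧F ρ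
  ⟦⟧F-weaken A a ρ = ⟦⟧F-ren suc A λ _ → refl

  ⟦⟧F-sub : ∀ {k k′} (s : Fin k → Form k′) (A : Form k) {ρ ρ′} →
            (∀ i → ⟦ s i ⟧F ρ ≡ ρ′ i) → ⟦ sub s A ⟧F ρ ≡ ⟦ A ⟧F ρ′
  ⟦⟧F-sub s (par a)  ⟦s⟧≗ρ′ = refl
  ⟦⟧F-sub s (tvar i) ⟦s⟧≗ρ′ = ⟦s⟧≗ρ′ i
  ⟦⟧F-sub s (A ⊗ᶠ B) ⟦s⟧≗ρ′ = cong₂ _⊗_ (⟦⟧F-sub s A ⟦s⟧≗ρ′) (⟦⟧F-sub s B ⟦s⟧≗ρ′)
  ⟦⟧F-sub s (¬ᶠ A)   ⟦s⟧≗ρ′ = cong ¬_ (⟦⟧F-sub s A ⟦s⟧≗ρ′)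
  ⟦⟧F-sub s (∃ᶠ A) {ρ} {ρ′} ⟦s⟧≗ρ′ = ∃ᶠ-cong (sub (exts s) A) A ρ ρ′ λ a →
    ⟦⟧F-sub (exts s) A λ
      { zero    → refl
      ; (suc i) → trans (⟦⟧F-weaken (s i) a ρ) (⟦s⟧≗ρ′ i) }

  ⟦⟧F-[/0] : ∀ {k} (A : Form (ℕ.suc k)) B ρ → ⟦ A [ B /0] ⟧F ρ ≡ ⟦ A ⟧F (⟦ B ⟧F ρ ∷ ρ)
  ⟦⟧F-[/0] A B ρ = ⟦⟧F-sub _ A λ { zero → refl ; (suc i) → refl }

  ⟦⟧F-lookup-weaken : ∀ {k n} (Γ : Vec (Form k) n) x a ρ →
                      ⟦ lookup (map weaken Γ) x ⟧F (a ∷ ρ) ≡ ⟦ lookup Γ x ⟧F ρ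
  ⟦⟧F-lookup-weaken Γ x a ρ = begin
    ⟦ lookup (map weaken Γ) x ⟧F (a ∷ ρ) ≡⟨ cong (λ G → ⟦ G ⟧F (a ∷ ρ)) (lookup-map x weaken Γ) ⟩
    ⟦ weaken (lookup Γ x) ⟧F (a ∷ ρ)     ≡⟨ ⟦⟧F-weaken (lookup Γ x) a ρ ⟩
    ⟦ lookup Γ x ⟧F ρ                    ∎
    where open ≡-Reasoning

  module _ {k : ℕ} {ρX : Vector Carrier k} where

    ⊩Γ-extend : ∀ {n} {Γ : Vec (Form k) n} {ρx A a} →
                (ρX , ρx) ⊩Γ Γ → a ≤ ⟦ A ⟧F ρX → (ρX , a ∷ ρx) ⊩Γ (A Vec.∷ Γ)
    ⊩Γ-extend σΓ a≤A zero    = a≤A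
    ⊩Γ-extend σΓ a≤A (suc x) = σΓ x

    ⊩Δ-extend : ∀ {m} {Δ : Vec (Form k) m} {ρα A a} →
                (ρX , ρα) ⊩Δ Δ → ⟦ A ⟧F ρX ≤ a → (ρX , a ∷ ρα) ⊩Δ (A Vec.∷ Δ)
    ⊩Δ-extend σΔ A≤a zero    = A≤a
    ⊩Δ-extend σΔ A≤a (suc α) = σΔ α

    ⊩Γ-weaken : ∀ {n} {Γ : Vec (Form k) n} {ρx} a →
                (ρX , ρx) ⊩Γ Γ → (a ∷ ρX , ρx) ⊩Γ map weaken Γ
    ⊩Γ-weaken {Γ = Γ} a σΓ x =
      ≤-trans (σΓ x) (≤-reflexive (sym (⟦⟧F-lookup-weaken Γ x a ρX)))

    ⊩Δ-weaken : ∀ {m} {Δ : Vec (Form k) m} {ρα} a →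
                (ρX , ρα) ⊩Δ Δ → (a ∷ ρX , ρα) ⊩Δ map weaken Δ
    ⊩Δ-weaken {Δ = Δ} a σΔ α =
      ≤-trans (≤-reflexive (⟦⟧F-lookup-weaken Δ α a ρX)) (σΔ α)

  mutual
    sound-term : ∀ {k n m} {Γ : Vec (Form k) n} {Δ : Vec (Form k) m} {ρX ρx ρα t A} →
                 (ρX , ρx) ⊩Γ Γ → (ρX , ρα) ⊩Δ Δ →
                 Γ ⊢ t ∶ A ∣ Δ → ⟦ t ⟧t ρx ρα ≤ ⟦ A ⟧F ρX
    sound-term σΓ σΔ (ax x refl) = σΓ x
    sound-term σΓ σΔ (μR ⊢c)     = ⋀-lower _ _ (sound-cmd σΓ (⊩Δ-extend σΔ ≤-refl) ⊢c)
    sound-term σΓ σΔ (⊗R ⊢t ⊢u)  = ⊗-mono (sound-term σΓ σΔ ⊢t) (sound-term σΓ σΔ ⊢u)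
    sound-term σΓ σΔ (¬R ⊢e)     = ¬-anti (sound-ctx σΓ σΔ ⊢e)
    sound-term {ρX = ρX} σΓ σΔ (∃R {A = A} {B} _ ⊢V) = begin
      _                        ≤⟨ sound-term σΓ σΔ ⊢V ⟩
      ⟦ A [ B /0] ⟧F ρX        ≡⟨ ⟦⟧F-[/0] A B ρX ⟩
      ⟦ A ⟧F (⟦ B ⟧F ρX ∷ ρX)  ≤⟨ ∃ᶠ-intro A _ ρX ⟩
      ⟦ ∃ᶠ A ⟧F ρX             ∎
      where open ≤-Reasoning ≤-poset

    sound-ctx : ∀ {k n m} {Γ : Vec (Form k) n} {Δ : Vec (Form k) m} {ρX ρx ρα e A} →
                (ρX , ρx) ⊩Γ Γ → (ρX , ρα) ⊩Δ Δ →
                Γ ∣ e ∶ A ⊢ Δ → ⟦ A ⟧F ρX ≤ ⟦ e ⟧e ρx ρα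
    sound-ctx σΓ σΔ (ax α refl) = σΔ α
    sound-ctx σΓ σΔ (μ̃L ⊢c) = ⋁-upper _ _ (sound-cmd (⊩Γ-extend σΓ ≤-refl) σΔ ⊢c)
    sound-ctx σΓ σΔ (⊗L ⊢c) =
      ⋁-upper _ _ (_ , _ , refl , sound-cmd (⊩Γ-extend (⊩Γ-extend σΓ ≤-refl) ≤-refl) σΔ ⊢c)
    sound-ctx σΓ σΔ (¬L ⊢c) = ⋁-upper _ _ (_ , refl , sound-cmd σΓ (⊩Δ-extend σΔ ≤-refl) ⊢c)
    sound-ctx {Γ = Γ} {Δ} {ρX} σΓ σΔ (∃L {A = A} ⊢e) =
      ∃ᶠ-elim A ρX λ a → sound-ctx (⊩Γ-weaken {Γ = Γ} a σΓ) (⊩Δ-weaken {Δ = Δ} a σΔ) ⊢e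

    sound-cmd : ∀ {k n m} {Γ : Vec (Form k) n} {Δ : Vec (Form k) m} {ρX ρx ρα c} →
                (ρX , ρx) ⊩Γ Γ → (ρX , ρα) ⊩Δ Δ →
                c ∶⟪ Γ ⊢ Δ ⟫ → Pole (⟦ c ⟧c ρx ρα)
    sound-cmd σΓ σΔ (cut ⊢t ⊢e) = ≤-trans (sound-term σΓ σΔ ⊢t) (sound-ctx σΓ σΔ ⊢e)

mainTheorem13 : ∀ {ℓ} (𝒜 : ConjunctiveStructure ℓ) →
    let open ConjunctiveStructure 𝒜
        open Lang 𝒜
    in ∀ {k n m : ℕ} (Γ : Vec (Form k) n) (Δ : Vec (Form k) m)
         (ρX : Vector Carrier k) (ρx : Vector Carrier n) (ρα : Vector Carrier m) →
       (ρX , ρx) ⊩Γ Γ → (ρX , ρα) ⊩Δ Δ →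
       (∀ (t : Term n m) (A : Form k) → Γ ⊢ t ∶ A ∣ Δ → ⟦ t ⟧t ρx ρα ≤ ⟦ A ⟧F ρX)
       × (∀ (e : Ctx n m) (A : Form k) → Γ ∣ e ∶ A ⊢ Δ → ⟦ A ⟧F ρX ≤ ⟦ e ⟧e ρx ρα)
       × (∀ (c : Cmd n m) → c ∶⟪ Γ ⊢ Δ ⟫ → Pole (⟦ c ⟧c ρx ρα))
mainTheorem13 𝒜 Γ Δ ρX ρx ρα σΓ σΔ =
    (λ _ _ → sound-term σΓ σΔ)
  , (λ _ _ → sound-ctx σΓ σΔ)
  , (λ _ → sound-cmd σΓ σΔ)
  where open Soundness 𝒜
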